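{- For every integer $n\ge 0$, \[ \binom{2n}{n}^2\sum_{k=0}^{n}\binom{n}{k}^2\binom{2n}{2k}=\binom{2n}{n}\sum_{k=0}^{n}\binom{2k}{k}\binom{2n-2k}{n-k}\binom{2n}{2k}^2. \]
   Context: $\binom{m}{j}$ is the usual binomial coefficient. -}

module Defs where

open import Data.Nat using (ℕ; zero; suc; _+_)

sumTo : ℕ → (ℕ → ℕ) → ℕ
sumTo zero    f = f zero
sumTo (suc n) f = sumTo n f + f (suc n)

{-# OPTIONS --safe #-}
module Submission where

open import Defs
open import Data.Nat using (ℕ; zero; suc; _+_; _*_; _∸_; _^_; _!; _≤_; z≤n)
open import Data.Nat.Properties
open import Data.Nat.DivMod using (m/n*n≡m)
open import Data.Nat.Combinatorics using (_C_; nCk≡n!/k![n-k]!; k![n∸k]!∣n!)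
open import Data.Nat.Tactic.RingSolver using (solve-∀)
open import Relation.Binary.PropositionalEquality
  using (_≡_; refl; sym; trans; cong; cong₂; module ≡-Reasoning)
open ≡-Reasoning

-- Termwise, both binomial products equal (2n)! / (k! (n-k)!)², so the identity
-- holds summand by summand once one factor C(2n,n) is pulled into the sum.

nCk*k!*[n∸k]!≡n! : ∀ {n k} → k ≤ n → (n C k) * (k ! * (n ∸ k) !) ≡ n !
nCk*k!*[n∸k]!≡n! {n} {k} k≤n =
  trans (cong (_* (k ! * (n ∸ k) !)) (nCk≡n!/k![n-k]! k≤n))
        (m/n*n≡m {{k !* (n ∸ k) !≢0}} (k![n∸k]!∣n! k≤n))

[2m]Cm*m!*m!≡[2m]! : ∀ m → ((2 * m) C m) * (m ! * m !) ≡ (2 * m) !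
[2m]Cm*m!*m!≡[2m]! m = begin
  ((2 * m) C m) * (m ! * m !)           ≡⟨ cong (λ j → ((2 * m) C m) * (m ! * j !)) 2m∸m≡m ⟨
  ((2 * m) C m) * (m ! * (2 * m ∸ m) !) ≡⟨ nCk*k!*[n∸k]!≡n! (m≤n*m m 2) ⟩
  (2 * m) ! ∎
  where
  2m∸m≡m : 2 * m ∸ m ≡ m
  2m∸m≡m = trans (m+n∸m≡n m (m + 0)) (+-identityʳ m)

[2k]Ck*[2n∸2k]C[n∸k]*[2n]C[2k]≡[2n]Cn*[nCk]² : ∀ {n k} → k ≤ n →
  ((2 * k) C k) * ((2 * n ∸ 2 * k) C (n ∸ k)) * ((2 * n) C (2 * k)) ≡ ((2 * n) C n) * (n C k) ^ 2
[2k]Ck*[2n∸2k]C[n∸k]*[2n]C[2k]≡[2n]Cn*[nCk]² {n} {k} k≤n =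
  *-cancelʳ-≡ _ _ (k!² * m!²) {{m*n≢0 _ _ {{k !* k !≢0}} {{m !* m !≢0}}}}
    (trans lhs≡[2n]! (sym rhs≡[2n]!))
  where
  m = n ∸ k
  k!² = k ! * k !
  m!² = m ! * m !

  [2n∸2k]Cm*m!²≡[2n∸2k]! : ((2 * n ∸ 2 * k) C m) * m!² ≡ (2 * n ∸ 2 * k) !
  [2n∸2k]Cm*m!²≡[2n∸2k]! rewrite sym (*-distribˡ-∸ 2 n k) = [2m]Cm*m!*m!≡[2m]! m

  regroupˡ : ∀ x y e p q → x * y * e * ((p * p) * (q * q)) ≡ e * ((x * (p * p)) * (y * (q * q)))
  regroupˡ = solve-∀

  regroupʳ : ∀ c s p q → c * (s * (s * 1)) * ((p * p) * (q * q)) ≡ c * ((s * (p * q)) * (s * (p * q)))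
  regroupʳ = solve-∀

  lhs≡[2n]! : ((2 * k) C k) * ((2 * n ∸ 2 * k) C m) * ((2 * n) C (2 * k)) * (k!² * m!²) ≡ (2 * n) !
  lhs≡[2n]! = begin
    ((2 * k) C k) * ((2 * n ∸ 2 * k) C m) * ((2 * n) C (2 * k)) * (k!² * m!²)
      ≡⟨ regroupˡ ((2 * k) C k) ((2 * n ∸ 2 * k) C m) ((2 * n) C (2 * k)) (k !) (m !) ⟩
    ((2 * n) C (2 * k)) * ((((2 * k) C k) * k!²) * (((2 * n ∸ 2 * k) C m) * m!²))
      ≡⟨ cong (((2 * n) C (2 * k)) *_) (cong₂ _*_ ([2m]Cm*m!*m!≡[2m]! k) [2n∸2k]Cm*m!²≡[2n∸2k]!) ⟩
    ((2 * n) C (2 * k)) * ((2 * k) ! * (2 * n ∸ 2 * k) !)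
      ≡⟨ nCk*k!*[n∸k]!≡n! (*-monoʳ-≤ 2 k≤n) ⟩
    (2 * n) ! ∎

  rhs≡[2n]! : ((2 * n) C n) * (n C k) ^ 2 * (k!² * m!²) ≡ (2 * n) !
  rhs≡[2n]! = begin
    ((2 * n) C n) * (n C k) ^ 2 * (k!² * m!²)
      ≡⟨ regroupʳ ((2 * n) C n) (n C k) (k !) (m !) ⟩
    ((2 * n) C n) * (((n C k) * (k ! * m !)) * ((n C k) * (k ! * m !)))
      ≡⟨ cong (λ t → ((2 * n) C n) * (t * t)) (nCk*k!*[n∸k]!≡n! k≤n) ⟩
    ((2 * n) C n) * (n ! * n !)
      ≡⟨ [2m]Cm*m!*m!≡[2m]! n ⟩
    (2 * n) ! ∎

sumTo-cong : ∀ n {f g : ℕ → ℕ} → (∀ {k} → k ≤ n → f k ≡ g k) → sumTo n f ≡ sumTo n g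
sumTo-cong zero    f≗g = f≗g z≤n
sumTo-cong (suc n) f≗g =
  cong₂ _+_ (sumTo-cong n (λ k≤n → f≗g (m≤n⇒m≤1+n k≤n))) (f≗g ≤-refl)

*-distribˡ-sumTo : ∀ c n (f : ℕ → ℕ) → c * sumTo n f ≡ sumTo n (λ k → c * f k)
*-distribˡ-sumTo c zero    f = refl
*-distribˡ-sumTo c (suc n) f =
  trans (*-distribˡ-+ c (sumTo n f) (f (suc n))) (cong (_+ c * f (suc n)) (*-distribˡ-sumTo c n f))

mainTheorem16 : (n : ℕ) →
    ((2 * n) C n) ^ 2 * sumTo n (λ k → ((n C k) ^ 2) * ((2 * n) C (2 * k)))
      ≡ ((2 * n) C n) * sumTo n (λ k → ((2 * k) C k) * ((2 * n ∸ 2 * k) C (n ∸ k)) * (((2 * n) C (2 * k)) ^ 2))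
mainTheorem16 n = begin
  c ^ 2 * sumTo n f            ≡⟨ square-assoc c (sumTo n f) ⟩
  c * (c * sumTo n f)          ≡⟨ cong (c *_) (*-distribˡ-sumTo c n f) ⟩
  c * sumTo n (λ k → c * f k)  ≡⟨ cong (c *_) (sumTo-cong n summand) ⟩
  c * sumTo n g ∎
  where
  c = (2 * n) C n
  f g : ℕ → ℕ
  f k = (n C k) ^ 2 * ((2 * n) C (2 * k))
  g k = ((2 * k) C k) * ((2 * n ∸ 2 * k) C (n ∸ k)) * ((2 * n) C (2 * k)) ^ 2

  square-assoc : ∀ x s → x * (x * 1) * s ≡ x * (x * s)
  square-assoc = solve-∀

  summand : ∀ {k} → k ≤ n → c * f k ≡ g k
  summand {k} k≤n = begin
    c * ((n C k) ^ 2 * e)   ≡⟨ *-assoc c ((n C k) ^ 2) e ⟨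
    c * (n C k) ^ 2 * e     ≡⟨ cong (_* e) ([2k]Ck*[2n∸2k]C[n∸k]*[2n]C[2k]≡[2n]Cn*[nCk]² k≤n) ⟨
    a * b * e * e           ≡⟨ *-assoc (a * b) e e ⟩
    a * b * (e * e)         ≡⟨ cong (λ t → a * b * (e * t)) (*-identityʳ e) ⟨
    g k ∎
    where
    a = (2 * k) C k
    b = (2 * n ∸ 2 * k) C (n ∸ k)
    e = (2 * n) C (2 * k)
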